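{- Let $v\ge1$, $\epsilon=1/50$, and $t\in\{0,1\}^v$. Suppose that for every $s\in\{0,1\}^v$ we are given a bit $b_s$ such that $b_s=1$ whenever $\langle s,t\rangle/v>\epsilon$ and $b_s=0$ whenever $\langle s,t\rangle/v<\epsilon/2$. Let $t'\in\{0,1\}^v$ be any vector consistent with all the $b_s$, in the sense that $\langle s,t'\rangle/v>\epsilon$ for all $s$ with $b_s=1$ and $\langle s,t'\rangle/v<\epsilon/2$ for all $s$ with $b_s=0$. Then the Hamming distance between $t$ and $t'$ is at most $v/25$.
   Context: $\langle\cdot,\cdot\rangle$ is the standard inner product of vectors in $\{0,1\}^v$ viewed as integer vectors. -}

module Defs where

open import Data.Nat using (ℕ; zero; suc; _+_; _*_)
open import Data.Bool using (Bool; true; false)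
open import Data.Vec using (Vec; []; _∷_)
open import Data.Integer using (+_)
open import Data.Rational using (ℚ; _/_)

bit : Bool → ℕ
bit true  = 1
bit false = 0

⟨_,_⟩ : ∀ {v} → Vec Bool v → Vec Bool v → ℕ
⟨ [] , [] ⟩ = 0
⟨ x ∷ xs , y ∷ ys ⟩ = bit x * bit y + ⟨ xs , ys ⟩

hamming : ∀ {v} → Vec Bool v → Vec Bool v → ℕ
hamming [] [] = 0
hamming (true ∷ xs) (false ∷ ys) = suc (hamming xs ys)
hamming (false ∷ xs) (true ∷ ys) = suc (hamming xs ys)
hamming (_ ∷ xs) (_ ∷ ys) = hamming xs ys

ratio : (v : ℕ) → Vec Bool (suc v) → Vec Bool (suc v) → ℚ
ratio v s t = (+ ⟨ s , t ⟩) / suc v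

ε : ℚ
ε = + 1 / 50

ε/2 : ℚ
ε/2 = + 1 / 100

bound : ℕ → ℚ
bound n = (+ n) / 25

-- Take the two tests s = t ∖ t′ and s = t′ ∖ t. The first is orthogonal to t′, so consistency of t′
-- forces b_s = 0, and then ⟨s,t⟩ ≤ εv; the second is orthogonal to t, so b_s = 0 and ⟨s,t′⟩ < εv/2.
-- These two inner products count the coordinates where t and t′ differ, so the Hamming distance
-- is less than (3/2)εv = 3v/100.
module Submission where

open import Defs
open import Data.Nat using (ℕ; suc)
open import Data.Bool using (Bool; true; false)
open import Data.Vec using (Vec)
open import Data.Integer using (+_)
open import Data.Rational using (ℚ; _<_; _≤_; _/_)
open import Relation.Binary.PropositionalEquality using (_≡_)

open import Data.Bool using (_∧_; not)
open import Data.Vec using ([]; _∷_; zipWith)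
import Data.Nat as ℕ
import Data.Nat.Properties as ℕ
import Data.Integer as ℤ
import Data.Integer.Properties as ℤ
open import Data.Rational using (toℚᵘ)
open import Data.Rational.Properties using (toℚᵘ-fromℚᵘ; toℚᵘ-mono-≤; toℚᵘ-cancel-≤;
  toℚᵘ-mono-<; toℚᵘ-cancel-<; ≮⇒≥)
open import Data.Rational.Unnormalised as ℚᵘ using (mkℚᵘ; _≃_; *≤*; *<*)
import Data.Rational.Unnormalised.Properties as ℚᵘ
open import Data.Nat.Tactic.RingSolver using (solve-∀)
open import Function using (_∘′_)
open import Function.Bundles using (_⇔_; mk⇔; Equivalence)
import Function.Properties.Equivalence as ⇔
open import Relation.Binary.PropositionalEquality using (refl; sym; trans; cong; subst; subst₂)
open import Relation.Nullary using (¬_)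

open Equivalence using (to; from)

toℚᵘ-/ : ∀ a b → toℚᵘ (+ a / suc b) ≃ mkℚᵘ (+ a) b
toℚᵘ-/ a b = toℚᵘ-fromℚᵘ (mkℚᵘ (+ a) b)

mkℚᵘ-≤⇔ : ∀ a b c d → mkℚᵘ (+ a) b ℚᵘ.≤ mkℚᵘ (+ c) d ⇔ a ℕ.* suc d ℕ.≤ c ℕ.* suc b
mkℚᵘ-≤⇔ a b c d = mk⇔
  (λ { (*≤* p) → ℤ.drop‿+≤+ (subst₂ ℤ._≤_ (sym (ℤ.pos-* a (suc d))) (sym (ℤ.pos-* c (suc b))) p) })
  (λ p → *≤* (subst₂ ℤ._≤_ (ℤ.pos-* a (suc d)) (ℤ.pos-* c (suc b)) (ℤ.+≤+ p)))

mkℚᵘ-<⇔ : ∀ a b c d → mkℚᵘ (+ a) b ℚᵘ.< mkℚᵘ (+ c) d ⇔ a ℕ.* suc d ℕ.< c ℕ.* suc b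
mkℚᵘ-<⇔ a b c d = mk⇔
  (λ { (*<* p) → ℤ.drop‿+<+ (subst₂ ℤ._<_ (sym (ℤ.pos-* a (suc d))) (sym (ℤ.pos-* c (suc b))) p) })
  (λ p → *<* (subst₂ ℤ._<_ (ℤ.pos-* a (suc d)) (ℤ.pos-* c (suc b)) (ℤ.+<+ p)))

/-≤⇔ : ∀ a b c d → + a / suc b ≤ + c / suc d ⇔ a ℕ.* suc d ℕ.≤ c ℕ.* suc b
/-≤⇔ a b c d = ⇔.trans (mk⇔ toℚᵘ-mono-≤ toℚᵘ-cancel-≤) (⇔.trans
  (mk⇔ (ℚᵘ.≤-respˡ-≃ (toℚᵘ-/ a b) ∘′ ℚᵘ.≤-respʳ-≃ (toℚᵘ-/ c d))
       (ℚᵘ.≤-respˡ-≃ (ℚᵘ.≃-sym (toℚᵘ-/ a b)) ∘′ ℚᵘ.≤-respʳ-≃ (ℚᵘ.≃-sym (toℚᵘ-/ c d))))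
  (mkℚᵘ-≤⇔ a b c d))

/-<⇔ : ∀ a b c d → + a / suc b < + c / suc d ⇔ a ℕ.* suc d ℕ.< c ℕ.* suc b
/-<⇔ a b c d = ⇔.trans (mk⇔ toℚᵘ-mono-< toℚᵘ-cancel-<) (⇔.trans
  (mk⇔ (ℚᵘ.<-respˡ-≃ (toℚᵘ-/ a b) ∘′ ℚᵘ.<-respʳ-≃ (toℚᵘ-/ c d))
       (ℚᵘ.<-respˡ-≃ (ℚᵘ.≃-sym (toℚᵘ-/ a b)) ∘′ ℚᵘ.<-respʳ-≃ (ℚᵘ.≃-sym (toℚᵘ-/ c d))))
  (mkℚᵘ-<⇔ a b c d))

_∖_ : ∀ {v} → Vec Bool v → Vec Bool v → Vec Bool v
_∖_ = zipWith (λ x y → x ∧ not y)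

⟨∖,⟩≡0 : ∀ {v} (s t : Vec Bool v) → ⟨ s ∖ t , t ⟩ ≡ 0
⟨∖,⟩≡0 []           []           = refl
⟨∖,⟩≡0 (false ∷ s)  (_ ∷ t)      = ⟨∖,⟩≡0 s t
⟨∖,⟩≡0 (true ∷ s)   (false ∷ t)  = ⟨∖,⟩≡0 s t
⟨∖,⟩≡0 (true ∷ s)   (true ∷ t)   = ⟨∖,⟩≡0 s t

hamming≡⟨∖,⟩+⟨∖,⟩ : ∀ {v} (t t′ : Vec Bool v) → hamming t t′ ≡ ⟨ t ∖ t′ , t ⟩ ℕ.+ ⟨ t′ ∖ t , t′ ⟩
hamming≡⟨∖,⟩+⟨∖,⟩ []           []            = refl
hamming≡⟨∖,⟩+⟨∖,⟩ (true ∷ t)   (true ∷ t′)   = hamming≡⟨∖,⟩+⟨∖,⟩ t t′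
hamming≡⟨∖,⟩+⟨∖,⟩ (true ∷ t)   (false ∷ t′)  = cong suc (hamming≡⟨∖,⟩+⟨∖,⟩ t t′)
hamming≡⟨∖,⟩+⟨∖,⟩ (false ∷ t)  (true ∷ t′)   =
  trans (cong suc (hamming≡⟨∖,⟩+⟨∖,⟩ t t′)) (sym (ℕ.+-suc _ _))
hamming≡⟨∖,⟩+⟨∖,⟩ (false ∷ t)  (false ∷ t′)  = hamming≡⟨∖,⟩+⟨∖,⟩ t t′

+-*25-≤ : ∀ a b n → a ℕ.* 50 ℕ.≤ n → b ℕ.* 100 ℕ.≤ n → (a ℕ.+ b) ℕ.* 25 ℕ.≤ n
+-*25-≤ a b n a≤ b≤ = ℕ.*-cancelʳ-≤ _ _ 4 (begin
  (a ℕ.+ b) ℕ.* 25 ℕ.* 4    ≡⟨ split a b ⟩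
  a ℕ.* 50 ℕ.* 2 ℕ.+ b ℕ.* 100  ≤⟨ ℕ.+-mono-≤ (ℕ.*-monoˡ-≤ 2 a≤) b≤ ⟩
  n ℕ.* 2 ℕ.+ n              ≤⟨ ℕ.m≤m+n (n ℕ.* 2 ℕ.+ n) n ⟩
  n ℕ.* 2 ℕ.+ n ℕ.+ n        ≡⟨ triple n ⟩
  n ℕ.* 4                    ∎)
  where
  open ℕ.≤-Reasoning
  split : ∀ a b → (a ℕ.+ b) ℕ.* 25 ℕ.* 4 ≡ a ℕ.* 50 ℕ.* 2 ℕ.+ b ℕ.* 100
  split = solve-∀
  triple : ∀ n → n ℕ.* 2 ℕ.+ n ℕ.+ n ≡ n ℕ.* 4
  triple = solve-∀

ε≮ratio-orthogonal : ∀ w (s t : Vec Bool (suc w)) → ⟨ s , t ⟩ ≡ 0 → ¬ (ε < ratio w s t)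
ε≮ratio-orthogonal w s t s⊥t ε<r =
  ℕ.n≮0 (to (/-<⇔ 1 49 0 w) (subst (λ k → ε < + k / suc w) s⊥t ε<r))

ratio-orthogonal<ε/2 : ∀ w (s t : Vec Bool (suc w)) → ⟨ s , t ⟩ ≡ 0 → ratio w s t < ε/2
ratio-orthogonal<ε/2 w s t s⊥t =
  subst (λ k → + k / suc w < ε/2) (sym s⊥t) (from (/-<⇔ 0 w 1 99) ℕ.z<s)

ratio≤ε⇒*50≤ : ∀ w (s t : Vec Bool (suc w)) → ratio w s t ≤ ε → ⟨ s , t ⟩ ℕ.* 50 ℕ.≤ suc w
ratio≤ε⇒*50≤ w s t r≤ε =
  subst (⟨ s , t ⟩ ℕ.* 50 ℕ.≤_) (ℕ.*-identityˡ (suc w)) (to (/-≤⇔ ⟨ s , t ⟩ w 1 49) r≤ε)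

ratio<ε/2⇒*100< : ∀ w (s t : Vec Bool (suc w)) → ratio w s t < ε/2 → ⟨ s , t ⟩ ℕ.* 100 ℕ.< suc w
ratio<ε/2⇒*100< w s t r<ε/2 =
  subst (⟨ s , t ⟩ ℕ.* 100 ℕ.<_) (ℕ.*-identityˡ (suc w)) (to (/-<⇔ ⟨ s , t ⟩ w 1 99) r<ε/2)

lemma4 : (w : ℕ) → (t : Vec Bool (suc w)) → (b : Vec Bool (suc w) → Bool)
    → (∀ s → ε < ratio w s t → b s ≡ true)
    → (∀ s → ratio w s t < ε/2 → b s ≡ false)
    → (t′ : Vec Bool (suc w))
    → (∀ s → b s ≡ true → ε < ratio w s t′)
    → (∀ s → b s ≡ false → ratio w s t′ < ε/2)
    → (+ hamming t t′) / 1 ≤ bound (suc w)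
lemma4 w t b h1 h0 t′ c1 c0 = from (/-≤⇔ (hamming t t′) 0 (suc w) 24)
  (subst₂ ℕ._≤_ (cong (ℕ._* 25) (sym (hamming≡⟨∖,⟩+⟨∖,⟩ t t′))) (sym (ℕ.*-identityʳ (suc w)))
    (+-*25-≤ ⟨ t ∖ t′ , t ⟩ ⟨ t′ ∖ t , t′ ⟩ (suc w) t∖t′-bound (ℕ.<⇒≤ t′∖t-bound)))
  where
  t∖t′-bound : ⟨ t ∖ t′ , t ⟩ ℕ.* 50 ℕ.≤ suc w
  t∖t′-bound = ratio≤ε⇒*50≤ w (t ∖ t′) t (≮⇒≥ λ ε<r →
    ε≮ratio-orthogonal w (t ∖ t′) t′ (⟨∖,⟩≡0 t t′) (c1 (t ∖ t′) (h1 (t ∖ t′) ε<r)))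
  t′∖t-bound : ⟨ t′ ∖ t , t′ ⟩ ℕ.* 100 ℕ.< suc w
  t′∖t-bound = ratio<ε/2⇒*100< w (t′ ∖ t) t′
    (c0 (t′ ∖ t) (h0 (t′ ∖ t) (ratio-orthogonal<ε/2 w (t′ ∖ t) t (⟨∖,⟩≡0 t′ t))))
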